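{- Let $G=(V,E)$ be a finite colored graph such that for every color $i$ the induced subgraph $G[V_i]$ on the set $V_i$ of nodes of color $i$ is connected, and let $s,t$ be distinct non-adjacent nodes of $G$. Let $G'$ be the graph constructed from $G$, $s$, $t$ as in the context. Then the $s't'$ node connectivity of $G'$ equals the value of the minimum color $st$ node cut in $G$.
   Context: Construction of $G'$: for each color $i$ create a node $u_i$; join $u_i$ and $u_j$ ($i\ne j$) if and only if $G$ has at least one edge between $V_i$ and $V_j$; add a new node $s'$ adjacent to exactly those $u_i$ for which $s$ is adjacent to some node of $V_i$, and a new node $t'$ adjacent to exactly those $u_i$ for which $t$ is adjacent to some node of $V_i$. For distinct non-adjacent nodes $x,y$ of a graph, an $xy$ node cut is a set of nodes not containing $x,y$ whose removal leaves $x$ and $y$ in different components; the $xy$ node connectivity is the minimum size of such a cut. A color $st$ node cut of $G$ is a set $C_c$ of colors such that the set of nodes whose colors lie in $C_c$ (possibly including $s$ or $t$) contains an $st$ node cut; the value of the minimum color $st$ node cut is the minimum size of such a $C_c$. -}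

module Defs where

open import Data.Nat using (ℕ; zero; suc; _≤_)
open import Data.Fin using (Fin; zero; suc)
open import Data.Fin.Subset using (Subset; _∈_; _∉_; _⊆_; ∣_∣)
open import Data.Product using (Σ; _×_; ∃; ∃-syntax; _,_)
open import Data.Empty using (⊥)
open import Relation.Nullary using (¬_)
open import Relation.Binary.PropositionalEquality using (_≡_; _≢_)

Rel : ℕ → Set₁
Rel N = Fin N → Fin N → Set

-- Reach Adj P x y : there is a walk from x to y in which every node
-- (including x and y) satisfies P, i.e. x and y are connected in the
-- subgraph induced by the nodes satisfying P.
data Reach {N : ℕ} (Adj : Rel N) (P : Fin N → Set) : Fin N → Fin N → Set where
  here : ∀ {x} → P x → Reach Adj P x x
  step : ∀ {x y z} → P x → Adj x y → Reach Adj P y z → Reach Adj P x z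

IsNodeCut : {N : ℕ} → Rel N → Fin N → Fin N → Subset N → Set
IsNodeCut Adj x y C = x ∉ C × y ∉ C × ¬ Reach Adj (λ v → v ∉ C) x y

NodeConnectivity≡ : {N : ℕ} → Rel N → Fin N → Fin N → ℕ → Set
NodeConnectivity≡ Adj x y m =
  (∃[ C ] (IsNodeCut Adj x y C × ∣ C ∣ ≡ m)) ×
  (∀ C → IsNodeCut Adj x y C → m ≤ ∣ C ∣)

IsColorCut : {n k : ℕ} → Rel n → (Fin n → Fin k) → Fin n → Fin n → Subset k → Set
IsColorCut Adj col s t Cc =
  ∃[ C ] ((∀ v → v ∈ C → col v ∈ Cc) × IsNodeCut Adj s t C)

MinColorCut≡ : {n k : ℕ} → Rel n → (Fin n → Fin k) → Fin n → Fin n → ℕ → Set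
MinColorCut≡ Adj col s t m =
  (∃[ Cc ] (IsColorCut Adj col s t Cc × ∣ Cc ∣ ≡ m)) ×
  (∀ Cc → IsColorCut Adj col s t Cc → m ≤ ∣ Cc ∣)

-- The graph G' on Fin (2 + k): node zero is s', node suc zero is t',
-- node suc (suc i) is u_i.
G' : {n k : ℕ} → Rel n → (Fin n → Fin k) → Fin n → Fin n → Rel (suc (suc k))
G' Adj col s t zero zero = ⊥
G' Adj col s t zero (suc zero) = ⊥
G' Adj col s t zero (suc (suc j)) = ∃[ v ] (col v ≡ j × Adj s v)
G' Adj col s t (suc zero) zero = ⊥
G' Adj col s t (suc zero) (suc zero) = ⊥
G' Adj col s t (suc zero) (suc (suc j)) = ∃[ v ] (col v ≡ j × Adj t v)
G' Adj col s t (suc (suc i)) zero = ∃[ v ] (col v ≡ i × Adj s v)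
G' Adj col s t (suc (suc i)) (suc zero) = ∃[ v ] (col v ≡ i × Adj t v)
G' Adj col s t (suc (suc i)) (suc (suc j)) =
  i ≢ j × ∃[ x ] ∃[ y ] (col x ≡ i × col y ≡ j × Adj x y)

s' : {k : ℕ} → Fin (suc (suc k))
s' = zero

t' : {k : ℕ} → Fin (suc (suc k))
t' = suc zero

module Submission where

-- The s't' node cuts of G' are exactly the "lifts" of colour sets: a node cut
-- of G' contains neither s' nor t', so it consists of colour nodes u_i only,
-- and the lift of a colour set Cc is the node set {u_i | i ∈ Cc}, which has
-- ∣ Cc ∣ elements.  The heart of the proof is the equivalence
--
--     lift Cc is an s't' node cut of G'  ⇔  Cc is a colour st node cut of G.
--
-- (⇐) An s't' walk in G' avoiding lift Cc is expanded into an st walk in G: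
--     every visited u_i is crossed inside the connected colour class V_i,
--     whose nodes all lie outside any cut coloured by Cc.
-- (⇒) Projecting nodes of G to G' (s ↦ s', t ↦ t', v ↦ u_(col v)) maps an st
--     walk in G that avoids the nodes coloured by Cc (other than s, t) to an
--     s't' walk in G' avoiding lift Cc.
--
-- Consequently both minimisation problems range over the same sizes.  To turn
-- this into the existence of a common minimum we need that "lift Cc is a cut"
-- is decidable, i.e. that reachability in a finite graph is decidable, and a
-- least-number principle; these general facts are developed first.

open import Defs
open import Data.Nat using (ℕ; zero; suc; _≤_; _<_) renaming (_≟_ to _≟ℕ_)
open import Data.Nat.Properties using (≮⇒≥; m<1+n⇒m<n∨m≡n; n<1+n)
open import Data.Fin using (Fin; zero; suc)
open import Data.Fin.Properties using (any?) renaming (_≟_ to _≟F_)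
open import Data.Fin.Subset using (Subset; _∈_; _∉_; ∣_∣; inside; outside; ⊤)
open import Data.Fin.Subset.Properties using (_∈?_; anySubset?; ∈⊤)
open import Data.Vec using (_∷_; here; there; tabulate)
open import Data.Vec.Properties using (lookup∘tabulate; []=⇒lookup; lookup⇒[]=)
open import Data.List using (List; []; _∷_; allFin)
open import Data.List.Membership.Propositional using () renaming (_∈_ to _∈ₗ_)
open import Data.List.Membership.Propositional.Properties using (∈-allFin)
open import Data.List.Membership.Propositional.Properties.Core using (∉[])
import Data.List.Relation.Unary.Any as Any
open import Data.Product using (∃; ∃-syntax; _×_; _,_; proj₁; proj₂)
open import Data.Sum using (_⊎_; inj₁; inj₂; [_,_])
open import Data.Empty using (⊥-elim)
open import Function.Bundles using (_⇔_; mk⇔)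
open import Relation.Nullary using (¬_; Dec; yes; no; does)
open import Relation.Nullary.Decidable using (_×-dec_; _⊎-dec_; ¬?; dec-true)
import Relation.Nullary.Decidable as Dec
open import Relation.Binary using (Decidable)
open import Relation.Binary.PropositionalEquality
  using (_≡_; _≢_; refl; sym; trans; cong)

module _ {N : ℕ} {A : Rel N} {P : Fin N → Set} where

  source : ∀ {x y} → Reach A P x y → P x
  source (here px)     = px
  source (step px _ _) = px

  concat : ∀ {x y z} → Reach A P x y → Reach A P y z → Reach A P x z
  concat (here _)      r' = r'
  concat (step px e r) r' = step px e (concat r r')

  extend : ∀ {x y z} → Reach A P x y → A y z → P z → Reach A P x z
  extend r e pz = concat r (step (target r) e (here pz))
    where
    target : ∀ {x y} → Reach A P x y → P y
    target (here py)    = py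
    target (step _ _ r) = target r

  weaken : {Q : Fin N → Set} → (∀ v → P v → Q v) → ∀ {x y} → Reach A P x y → Reach A Q x y
  weaken f (here px)     = here (f _ px)
  weaken f (step px e r) = step (f _ px) e (weaken f r)

-- A walk
-- inside P either avoids a given node a, or splits at its first and last visit
-- of a into pieces avoiding a; removing the allowed nodes one at a time thus
-- reduces the question to walks inside the empty set.
module Reachability {N : ℕ} (A : Rel N) (A? : Decidable A) where

  _without_ : (Fin N → Set) → Fin N → Fin N → Set
  (P without a) v = P v × v ≢ a

  ReachInto : (Fin N → Set) → Fin N → Fin N → Set
  ReachInto Q x a = x ≡ a ⊎ ∃[ z ] (Reach A Q x z × A z a)

  ReachOutOf : (Fin N → Set) → Fin N → Fin N → Set
  ReachOutOf Q a y = a ≡ y ⊎ ∃[ z ] (A a z × Reach A Q z y)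

  Split : (Fin N → Set) → Fin N → Fin N → Fin N → Set
  Split P a x y =
    Reach A (P without a) x y ⊎ (P a × ReachInto (P without a) x a × ReachOutOf (P without a) a y)

  module _ {P : Fin N → Set} {a : Fin N} where

    first-visit : ∀ {x y} → Reach A P x y →
      Reach A (P without a) x y ⊎ (ReachInto (P without a) x a × Reach A P a y)
    first-visit {x} r with x ≟F a
    ... | yes refl = inj₂ (inj₁ refl , r)
    first-visit (here px)     | no x≢a = inj₁ (here (px , x≢a))
    first-visit (step px e r) | no x≢a with first-visit r
    ... | inj₁ r'                        = inj₁ (step (px , x≢a) e r')
    ... | inj₂ (inj₁ refl , ra)          = inj₂ (inj₂ (_ , here (px , x≢a) , e) , ra)
    ... | inj₂ (inj₂ (z , rz , ez) , ra) = inj₂ (inj₂ (z , step (px , x≢a) e rz , ez) , ra)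

    last-visit : ∀ {w y} → Reach A P w y → Reach A (P without a) w y ⊎ ReachOutOf (P without a) a y
    last-visit {w} (here pw) with w ≟F a
    ... | yes refl = inj₂ (inj₁ refl)
    ... | no w≢a   = inj₁ (here (pw , w≢a))
    last-visit {w} (step pw e r) with last-visit r
    ... | inj₂ out = inj₂ out
    ... | inj₁ r' with w ≟F a
    ...   | yes refl = inj₂ (inj₂ (_ , e , r'))
    ...   | no w≢a   = inj₁ (step (pw , w≢a) e r')

    split-at : ∀ {x y} → Split P a x y ⇔ Reach A P x y
    split-at = mk⇔ from to
      where
      to : ∀ {x y} → Reach A P x y → Split P a x y
      to r with first-visit r
      ... | inj₁ r' = inj₁ r'
      ... | inj₂ (into , ra) with last-visit ra
      ...   | inj₁ ra' = ⊥-elim (proj₂ (source ra') refl)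
      ...   | inj₂ out = inj₂ (source ra , into , out)

      drop : ∀ {x y} → Reach A (P without a) x y → Reach A P x y
      drop = weaken (λ _ → proj₁)

      into-walk : ∀ {x} → P a → ReachInto (P without a) x a → Reach A P x a
      into-walk pa (inj₁ refl)          = here pa
      into-walk pa (inj₂ (_ , r , e))   = extend (drop r) e pa

      out-walk : ∀ {y} → P a → ReachOutOf (P without a) a y → Reach A P a y
      out-walk pa (inj₁ refl)           = here pa
      out-walk pa (inj₂ (_ , e , r))    = step pa e (drop r)

      from : ∀ {x y} → Split P a x y → Reach A P x y
      from (inj₁ r)                 = drop r
      from (inj₂ (pa , into , out)) = concat (into-walk pa into) (out-walk pa out)

  reach-within? : (L : List (Fin N)) {P : Fin N → Set} → (∀ v → Dec (P v)) →
    (∀ v → P v → v ∈ₗ L) → Decidable (Reach A P)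
  reach-within? [] P? ⊆L x y = no λ r → ∉[] (⊆L x (source r))
  reach-within? (a ∷ L) {P} P? ⊆L x y =
    Dec.map split-at (avoiding? x y ⊎-dec (P? a ×-dec (into? ×-dec outOf?)))
    where
    P⁻? : ∀ v → Dec ((P without a) v)
    P⁻? v = P? v ×-dec ¬? (v ≟F a)

    ⊆L⁻ : ∀ v → (P without a) v → v ∈ₗ L
    ⊆L⁻ v (pv , v≢a) with ⊆L v pv
    ... | Any.here v≡a = ⊥-elim (v≢a v≡a)
    ... | Any.there v∈L = v∈L

    avoiding? : Decidable (Reach A (P without a))
    avoiding? = reach-within? L P⁻? ⊆L⁻

    into? : Dec (ReachInto (P without a) x a)
    into? = (x ≟F a) ⊎-dec any? (λ z → avoiding? x z ×-dec A? z a)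

    outOf? : Dec (ReachOutOf (P without a) a y)
    outOf? = (a ≟F y) ⊎-dec any? (λ z → A? a z ×-dec avoiding? z y)

  reach? : {P : Fin N → Set} → (∀ v → Dec (P v)) → Decidable (Reach A P)
  reach? P? = reach-within? (allFin N) P? (λ v _ → ∈-allFin v)

module _ {D : ℕ → Set} (D? : ∀ m → Dec (D m)) where

  Least : Set
  Least = ∃[ m ] (D m × (∀ j → D j → m ≤ j))

  least-below : ∀ M → (∀ j → j < M → ¬ D j) ⊎ Least
  least-below zero = inj₁ (λ _ ())
  least-below (suc M) with least-below M
  ... | inj₂ least = inj₂ least
  ... | inj₁ none with D? M
  ...   | yes dM = inj₂ (M , dM , λ j dj → ≮⇒≥ (λ j<M → none j j<M dj))
  ...   | no ¬dM = inj₁ (λ j j<1+M → [ none j , (λ { refl → ¬dM }) ] (m<1+n⇒m<n∨m≡n j<1+M))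

  least-number : ∀ {M} → D M → Least
  least-number {M} dM with least-below (suc M)
  ... | inj₁ none  = ⊥-elim (none M (n<1+n M) dM)
  ... | inj₂ least = least

minimal-subset : {k : ℕ} {Q : Subset k → Set} → (∀ S → Dec (Q S)) → ∃ Q →
  ∃[ S ] (Q S × (∀ S' → Q S' → ∣ S ∣ ≤ ∣ S' ∣))
minimal-subset {Q = Q} Q? (S₀ , q₀) with least-number sized? (S₀ , q₀ , refl)
  where
  sized? : ∀ m → Dec (∃[ S ] (Q S × ∣ S ∣ ≡ m))
  sized? m = anySubset? (λ S → Q? S ×-dec (∣ S ∣ ≟ℕ m))
... | _ , (S , q , refl) , least = S , q , λ S' q' → least ∣ S' ∣ (S' , q' , refl)

module _ {n : ℕ} {P : Fin n → Set} (P? : ∀ v → Dec (P v)) where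

  toSubset : Subset n
  toSubset = tabulate (λ v → does (P? v))

  ∈-toSubset⁺ : ∀ {v} → P v → v ∈ toSubset
  ∈-toSubset⁺ {v} pv = lookup⇒[]= v toSubset (trans (lookup∘tabulate _ v) (dec-true (P? v) pv))

  ∈-toSubset⁻ : ∀ {v} → v ∈ toSubset → P v
  ∈-toSubset⁻ {v} v∈ with P? v | trans (sym (lookup∘tabulate _ v)) ([]=⇒lookup v∈)
  ... | yes pv | _ = pv
  ... | no _   | ()

module ColourGraph {n k : ℕ} (Adj : Rel n) (Adj? : Decidable Adj)
    (symmetric : ∀ x y → Adj x y → Adj y x)
    (col : Fin n → Fin k)
    (connected : ∀ i x y → col x ≡ i → col y ≡ i → Reach Adj (λ v → col v ≡ i) x y)
    (s t : Fin n) (s≢t : s ≢ t) (s≁t : ¬ Adj s t) where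

  G : Rel (suc (suc k))
  G = G' Adj col s t

  u : Fin k → Fin (suc (suc k))
  u i = suc (suc i)

  G? : Decidable G
  G? zero          zero          = no λ ()
  G? zero          (suc zero)    = no λ ()
  G? zero          (suc (suc j)) = any? (λ v → (col v ≟F j) ×-dec Adj? s v)
  G? (suc zero)    zero          = no λ ()
  G? (suc zero)    (suc zero)    = no λ ()
  G? (suc zero)    (suc (suc j)) = any? (λ v → (col v ≟F j) ×-dec Adj? t v)
  G? (suc (suc i)) zero          = any? (λ v → (col v ≟F i) ×-dec Adj? s v)
  G? (suc (suc i)) (suc zero)    = any? (λ v → (col v ≟F i) ×-dec Adj? t v)
  G? (suc (suc i)) (suc (suc j)) =
    ¬? (i ≟F j) ×-dec any? (λ x → any? (λ y → (col x ≟F i) ×-dec ((col y ≟F j) ×-dec Adj? x y)))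

  lift : Subset k → Subset (suc (suc k))
  lift Cc = outside ∷ outside ∷ Cc

  LiftedCut : Subset k → Set
  LiftedCut Cc = IsNodeCut G s' t' (lift Cc)

  t'∉lift : ∀ {Cc} → t' ∉ lift Cc
  t'∉lift (there ())

  cut-is-lift : ∀ C' → s' ∉ C' → t' ∉ C' → ∃[ Cc ] (C' ≡ lift Cc)
  cut-is-lift (inside ∷ _)            s'∉ _   = ⊥-elim (s'∉ here)
  cut-is-lift (outside ∷ inside ∷ _)  _   t'∉ = ⊥-elim (t'∉ (there here))
  cut-is-lift (outside ∷ outside ∷ Cc) _  _   = Cc , refl

  -- all neighbours of s' are colour nodes, so the set of all of them is a cut
  all-colours-cut : LiftedCut ⊤
  all-colours-cut = (λ ()) , t'∉lift , blocked
    where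
    blocked : ¬ Reach G (λ w → w ∉ lift ⊤) s' t'
    blocked (step {y = zero}        _ () _)
    blocked (step {y = suc zero}    _ () _)
    blocked (step {y = suc (suc _)} _ _  r) = source r (there (there ∈⊤))

  LiftedCut? : ∀ Cc → Dec (LiftedCut Cc)
  LiftedCut? Cc = yes (λ ()) ×-dec (yes t'∉lift ×-dec
    ¬? (Reachability.reach? G G? (λ w → ¬? (w ∈? lift Cc)) s' t'))

  Over : Fin (suc (suc k)) → Fin n → Set
  Over zero          x = x ≡ s
  Over (suc zero)    x = x ≡ t
  Over (suc (suc i)) x = col x ≡ i

  module Expand (Cc : Subset k) (C : Subset n) (coloured : ∀ v → v ∈ C → col v ∈ Cc)
                (s∉C : s ∉ C) (t∉C : t ∉ C) where

    Avoid : Fin n → Set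
    Avoid v = v ∉ C

    colour-avoids : ∀ {i x} → u i ∉ lift Cc → col x ≡ i → x ∉ C
    colour-avoids u∉ refl x∈C = u∉ (there (there (coloured _ x∈C)))

    colour-walk : ∀ {i x y} → u i ∉ lift Cc → col x ≡ i → col y ≡ i → Reach Adj Avoid x y
    colour-walk {i} u∉ cx cy = weaken (λ _ cv → colour-avoids u∉ cv) (connected i _ _ cx cy)

    expand-edge : ∀ {w w' x} → G w w' → w ∉ lift Cc → w' ∉ lift Cc → Over w x →
      ∃[ y ] (Over w' y × Reach Adj Avoid x y)
    expand-edge {zero}        {zero}        ()
    expand-edge {zero}        {suc zero}    ()
    expand-edge {suc zero}    {zero}        ()
    expand-edge {suc zero}    {suc zero}    ()
    expand-edge {zero}        {suc (suc _)} (v , cv , sv) _ w'∉ refl =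
      v , cv , step s∉C sv (here (colour-avoids w'∉ cv))
    expand-edge {suc zero}    {suc (suc _)} (v , cv , tv) _ w'∉ refl =
      v , cv , step t∉C tv (here (colour-avoids w'∉ cv))
    expand-edge {suc (suc _)} {zero}        (v , cv , sv) w∉ _ cx =
      s , refl , extend (colour-walk w∉ cx cv) (symmetric s v sv) s∉C
    expand-edge {suc (suc _)} {suc zero}    (v , cv , tv) w∉ _ cx =
      t , refl , extend (colour-walk w∉ cx cv) (symmetric t v tv) t∉C
    expand-edge {suc (suc _)} {suc (suc _)} (_ , a , b , ca , cb , ab) w∉ w'∉ cx =
      b , cb , extend (colour-walk w∉ cx ca) ab (colour-avoids w'∉ cb)

    expand : ∀ {w x} → Reach G (λ w → w ∉ lift Cc) w t' → Over w x → Reach Adj Avoid x t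
    expand (here _)       refl = here t∉C
    expand (step w∉ e r) over with expand-edge e w∉ (source r) over
    ... | y , over' , xy = concat xy (expand r over')

  colour-cut⇒lifted-cut : ∀ {Cc} → IsColorCut Adj col s t Cc → LiftedCut Cc
  colour-cut⇒lifted-cut {Cc} (C , coloured , s∉C , t∉C , cut) =
    (λ ()) , t'∉lift , λ r → cut (expand r refl)
    where open Expand Cc C coloured s∉C t∉C

  data Image (x : Fin n) : Fin (suc (suc k)) → Set where
    at-s      : x ≡ s → Image x s'
    at-t      : x ≡ t → Image x t'
    elsewhere : x ≢ s → x ≢ t → Image x (u (col x))

  image : ∀ x → ∃ (Image x)
  image x with x ≟F s | x ≟F t
  ... | yes x≡s | _       = s' , at-s x≡s
  ... | no x≢s  | yes x≡t = t' , at-t x≡t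
  ... | no x≢s  | no x≢t  = u (col x) , elsewhere x≢s x≢t

  project-edge : ∀ {x y w w'} → Adj x y → Image x w → Image y w' → w ≡ w' ⊎ G w w'
  project-edge e (at-s refl)       (at-s refl)       = inj₁ refl
  project-edge e (at-s refl)       (at-t refl)       = ⊥-elim (s≁t e)
  project-edge e (at-s refl)       (elsewhere _ _)   = inj₂ (_ , refl , e)
  project-edge e (at-t refl)       (at-s refl)       = ⊥-elim (s≁t (symmetric _ _ e))
  project-edge e (at-t refl)       (at-t refl)       = inj₁ refl
  project-edge e (at-t refl)       (elsewhere _ _)   = inj₂ (_ , refl , e)
  project-edge e (elsewhere _ _)   (at-s refl)       = inj₂ (_ , refl , symmetric _ _ e)
  project-edge e (elsewhere _ _)   (at-t refl)       = inj₂ (_ , refl , symmetric _ _ e)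
  project-edge {x} {y} e (elsewhere _ _) (elsewhere _ _) with col x ≟F col y
  ... | yes same = inj₁ (cong u same)
  ... | no differ = inj₂ (differ , x , y , refl , refl , e)

  module Project (Cc : Subset k) where

    Interior : Fin n → Set
    Interior v = col v ∈ Cc × v ≢ s × v ≢ t

    Interior? : ∀ v → Dec (Interior v)
    Interior? v = (col v ∈? Cc) ×-dec (¬? (v ≟F s) ×-dec ¬? (v ≟F t))

    C₀ : Subset n
    C₀ = toSubset Interior?

    image-avoids : ∀ {x w} → x ∉ C₀ → Image x w → w ∉ lift Cc
    image-avoids _   (at-s _)          = λ ()
    image-avoids _   (at-t _)          = t'∉lift
    image-avoids x∉ (elsewhere x≢s x≢t) (there (there c)) = x∉ (∈-toSubset⁺ Interior? (c , x≢s , x≢t))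

    project : ∀ {x w} → Reach Adj (λ v → v ∉ C₀) x t → Image x w → Reach G (λ w → w ∉ lift Cc) w t'
    project (here _) (at-s t≡s)        = ⊥-elim (s≢t (sym t≡s))
    project (here _) (at-t _)          = here t'∉lift
    project (here _) (elsewhere _ t≢t) = ⊥-elim (t≢t refl)
    project (step {y = y} x∉ e r) img with image y
    ... | w' , img' with project-edge e img img'
    ...   | inj₁ refl = project r img'
    ...   | inj₂ e'   = step (image-avoids x∉ img) e' (project r img')

  lifted-cut⇒colour-cut : ∀ {Cc} → LiftedCut Cc → IsColorCut Adj col s t Cc
  lifted-cut⇒colour-cut {Cc} (_ , _ , cut) =
    C₀ , (λ v v∈ → proj₁ (member v∈)) ,
    (λ s∈ → proj₁ (proj₂ (member s∈)) refl) , (λ t∈ → proj₂ (proj₂ (member t∈)) refl) ,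
    λ r → cut (project r (at-s refl))
    where
    open Project Cc
    member : ∀ {v} → v ∈ C₀ → Interior v
    member = ∈-toSubset⁻ Interior?

-- A minimum-size lifted cut Cc gives both optima: lift Cc is a minimum s't' node
-- cut of G' (all cuts are lifts) and Cc a minimum colour st node cut of G.
lemma1 : (n k : ℕ) (Adj : Rel n) → Decidable Adj
    → (∀ x y → Adj x y → Adj y x) → (∀ x → ¬ Adj x x)
    → (col : Fin n → Fin k)
    → (∀ i x y → col x ≡ i → col y ≡ i → Reach Adj (λ v → col v ≡ i) x y)
    → (s t : Fin n) → s ≢ t → ¬ Adj s t
    → ∃[ m ] (NodeConnectivity≡ (G' Adj col s t) s' t' m × MinColorCut≡ Adj col s t m)
lemma1 n k Adj Adj? symmetric _ col connected s t s≢t s≁t =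
  conclude (minimal-subset LiftedCut? (⊤ , all-colours-cut))
  where
  open ColourGraph Adj Adj? symmetric col connected s t s≢t s≁t

  conclude : ∃[ Cc ] (LiftedCut Cc × (∀ Cc' → LiftedCut Cc' → ∣ Cc ∣ ≤ ∣ Cc' ∣)) →
    ∃[ m ] (NodeConnectivity≡ G s' t' m × MinColorCut≡ Adj col s t m)
  conclude (Cc , cut , minimal) =
    ∣ Cc ∣ , ((lift Cc , cut , refl) , node-bound) , ((Cc , lifted-cut⇒colour-cut cut , refl) , colour-bound)
    where
    node-bound : ∀ C' → IsNodeCut G s' t' C' → ∣ Cc ∣ ≤ ∣ C' ∣
    node-bound C' cut' with cut-is-lift C' (proj₁ cut') (proj₁ (proj₂ cut'))
    ... | Cc' , refl = minimal Cc' cut'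

    colour-bound : ∀ Cc' → IsColorCut Adj col s t Cc' → ∣ Cc ∣ ≤ ∣ Cc' ∣
    colour-bound Cc' colour-cut = minimal Cc' (colour-cut⇒lifted-cut colour-cut)
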